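{- Let $z\in S_\infty$ be an involution with $\{i>0:z(i)\ne i\}\subseteq[a,b]$ for integers $a\le b$. Then $\operatorname{supp}(v)\subseteq[a,b]$ for all $v\in\mathcal{B}_{\mathsf{inv}}(z)$ and $\operatorname{supp}(w)\subseteq[a-1,b+1]$ for all $w\in\mathcal{B}_{\mathsf{inv}}^+(z)$.
   Context: $S_\infty$: permutations of $\mathbb{Z}$ fixing $i\le0$ and all but finitely many $i$; $\ell$ = number of inversions; $\operatorname{supp}(w)=\{i>0:w(i)\ne i\}$; $[a,b]=\{i\in\mathbb{Z}:a\le i\le b\}$. Demazure product $\circ$: associative, $s_i\circ w=s_iw$ if $\ell(s_iw)>\ell(w)$ else $w$ (symmetrically on the right); $\mathcal{B}_{\mathsf{inv}}(z)=\{w:w^{ -1}\circ w=z\}$. Let $k(z)=\min\{i\ge0:z(j)\le j\ \forall j>i\}$, and $j(z)=\max\{j\in\mathbb{Z}_{\ge0}:z(i)=i\text{ for all }1\le i\le j\}$ for $z\ne1$, $j(1)=1$. For $v,w\in S_\infty$ and $c<d$ write $v\xrightarrow{(c,d)}w$ if $w=v\cdot(c,d)$ and $\ell(w)=\ell(v)+1$. An unmarked $k$-Pieri chain from $v$ to $w$ is $v=v_0\xrightarrow{(a_1,b_1)}\cdots\xrightarrow{(a_q,b_q)}v_q=w$ ($q\ge0$) with $1\le a_i\le k<b_i$, (P0) if $a_j=a_i>a_{i+1}$ for some $1\le j<i<q$ then $b_i>b_{i+1}$, (P1) $b_1\ge\cdots\ge b_q$. Write $v\xrightarrow{[z]}w$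 if there is such a chain with $k=k(z)$ satisfying, for each $i$, $j(z)\le a_i$ and ($a_i<z(a_i)$ or $z(b_i)<b_i$). $\mathcal{B}_{\mathsf{inv}}^+(z)=\{w:v\xrightarrow{[z]}w\text{ for some }v\in\mathcal{B}_{\mathsf{inv}}(z)\}$. -}

module Defs where

open import Data.Nat using (ℕ; zero; suc; _+_; _∸_; _≤_; _<_; _≡ᵇ_; _<ᵇ_)
open import Data.Bool using (if_then_else_)
open import Data.Product using (_×_; Σ; ∃; ∃-syntax)
open import Data.Sum using (_⊎_)
open import Data.Integer as ℤ using (ℤ; +_)
open import Relation.Nullary using (¬_)
open import Relation.Binary.PropositionalEquality using (_≡_; refl; sym; trans; cong)

-- A permutation of ℤ fixing every i ≤ 0 and all but finitely many i is
-- determined by its restriction to ℕ = {0,1,2,...}, which is a bijection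
-- of ℕ fixing 0 and fixing every i > some bound.

record Perm : Set where
  field
    fun     : ℕ → ℕ
    inv     : ℕ → ℕ
    inv-fun : ∀ i → inv (fun i) ≡ i
    fun-inv : ∀ i → fun (inv i) ≡ i
    fix0    : fun 0 ≡ 0
    bound   : ℕ
    fixed   : ∀ i → bound < i → fun i ≡ i
open Perm public

_≈_ : Perm → Perm → Set
v ≈ w = ∀ i → fun v i ≡ fun w i

IsId : Perm → Set
IsId w = ∀ i → fun w i ≡ i

IsInvolution : Perm → Set
IsInvolution z = ∀ i → fun z (fun z i) ≡ i

_⁻¹ : Perm → Perm
w ⁻¹ = record
  { fun = inv w ; inv = fun w ; inv-fun = fun-inv w ; fun-inv = inv-fun w
  ; fix0 = trans (cong (inv w) (sym (fix0 w))) (inv-fun w 0)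
  ; bound = bound w
  ; fixed = λ i p → trans (cong (inv w) (sym (fixed w i p))) (inv-fun w i) }

cntAbove : (ℕ → ℕ) → ℕ → ℕ → ℕ
cntAbove f j zero    = 0
cntAbove f j (suc k) = (if f j <ᵇ f (suc k) then 1 else 0) + cntAbove f j k

invCount : (ℕ → ℕ) → ℕ → ℕ
invCount f zero    = 0
invCount f (suc n) = invCount f n + cntAbove f (suc n) n

-- all inversions lie in [1, bound w]
ℓ : Perm → ℕ
ℓ w = invCount (fun w) (bound w)

swap : ℕ → ℕ → ℕ → ℕ
swap c d i = if i ≡ᵇ c then d else (if i ≡ᵇ d then c else i)

RightTransp : Perm → Perm → ℕ → ℕ → Set
RightTransp w v c d = ∀ j → fun w j ≡ fun v (swap c d j)

-- Dem u w r  means  u ∘ w = r.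
-- Defined by recursion along a reduced factorisation of w:
--   u ∘ 1 = u,
--   u ∘ (w' s_i) = (u ∘ w') ∘ s_i   when ℓ(w' s_i) = ℓ(w') + 1,
-- and  r ∘ s_i = r s_i if ℓ(r s_i) > ℓ(r), else r.
-- (The result is independent of the chosen reduced factorisation.)

data Dem (u : Perm) : Perm → Perm → Set where
  dem-one : ∀ {w r} → IsId w → r ≈ u → Dem u w r
  dem-asc : ∀ {w w' r' r} (i : ℕ) → 1 ≤ i →
            RightTransp w w' i (suc i) → ℓ w ≡ suc (ℓ w') →
            Dem u w' r' →
            RightTransp r r' i (suc i) → ℓ r' < ℓ r →
            Dem u w r
  dem-des : ∀ {w w' r' r t} (i : ℕ) → 1 ≤ i →
            RightTransp w w' i (suc i) → ℓ w ≡ suc (ℓ w') →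
            Dem u w' r' →
            RightTransp t r' i (suc i) → ℓ t < ℓ r' → r ≈ r' →
            Dem u w r

InBinv : Perm → Perm → Set
InBinv z w = Dem (w ⁻¹) w z

BelowDiagAbove : Perm → ℕ → Set
BelowDiagAbove z i = ∀ j → i < j → fun z j ≤ j

IsK : Perm → ℕ → Set
IsK z k = BelowDiagAbove z k × (∀ i → BelowDiagAbove z i → k ≤ i)

InitFixed : Perm → ℕ → Set
InitFixed z j = ∀ i → 1 ≤ i → i ≤ j → fun z i ≡ i

IsJ : Perm → ℕ → Set
IsJ z j = (IsId z → j ≡ 1)
        × (¬ IsId z → InitFixed z j × (∀ j' → InitFixed z j' → j' ≤ j))

record PieriChain (k : ℕ) (v w : Perm) : Set where
  field
    q     : ℕ
    vs    : ℕ → Perm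
    a b   : ℕ → ℕ
    start : vs 0 ≈ v
    end   : vs q ≈ w
    cover : ∀ i → 1 ≤ i → i ≤ q →
            a i < b i × RightTransp (vs i) (vs (i ∸ 1)) (a i) (b i)
                      × ℓ (vs i) ≡ suc (ℓ (vs (i ∸ 1)))
    range : ∀ i → 1 ≤ i → i ≤ q → 1 ≤ a i × a i ≤ k × k < b i
    P0    : ∀ j i → 1 ≤ j → j < i → i < q →
            a j ≡ a i → a (suc i) < a i → b (suc i) < b i
    P1    : ∀ i → 1 ≤ i → i < q → b (suc i) ≤ b i
open PieriChain public

ZChain : Perm → Perm → Perm → Set
ZChain z v w = ∃[ k ] ∃[ jz ] (IsK z k × IsJ z jz ×
  Σ (PieriChain k v w) (λ c → ∀ i → 1 ≤ i → i ≤ q c →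
     jz ≤ a c i × (a c i < fun z (a c i) ⊎ fun z (b c i) < b c i)))

InBinvPlus : Perm → Perm → Set
InBinvPlus z w = ∃[ v ] (InBinv z v × ZChain z v w)

SuppIn : Perm → ℤ → ℤ → Set
SuppIn w a b = ∀ i → 0 < i → ¬ (fun w i ≡ i) → (a ℤ.≤ + i) × (+ i ℤ.≤ b)

-- The Demazure product u ∘ w lies above w in Bruhat order, which is expressed through the rank counts
-- #{j ∈ [1,p] : w(j) ≤ q}.  So v⁻¹ ∘ v = z gives v ≤ z, and v stabilises [1,p] whenever z does.  A
-- permutation z supported in [a,b] stabilises [1,p] for p < a and for p ≥ b, and a permutation stabilising
-- both [1,p] and [1,p+1] fixes p+1; hence v is supported in [a,b].
-- Along a chain v →[z] w each step multiplies by a transposition (a_i, b_i) inside [a−1, b+1]: either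
-- a_i ∈ supp z, or z(b_i) < b_i makes z ≠ 1 and then a_i ≥ j(z) ≥ a−1.  Moreover b_i ≤ b_1 ≤ b+1: either
-- b_1 ∈ supp z, or a_1 ∈ supp z and the cover v → v·(a_1, b_1) cannot jump over the fixed point b+1 of v,
-- since an e ∈ (c,d) with x(c) < x(e) < x(d) makes ℓ(x·(c,d)) exceed ℓ(x) by at least 3.

module Submission where

open import Defs
open import Data.Bool using (if_then_else_)
open import Data.Empty using (⊥; ⊥-elim)
open import Data.Integer as ℤ using (ℤ; +_; +≤+; +<+; 1ℤ)
import Data.Integer.Properties as ℤP
open import Data.Nat using (ℕ; zero; suc; _+_; _⊔_; _≤_; _<_; _≤′_; _<′_; ≤′-refl; ≤′-step; z≤n; s≤s; NonZero; >-nonZero; ≢-nonZero⁻¹)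
open import Data.Nat.Properties
open import Algebra.Properties.CommutativeSemigroup +-commutativeSemigroup using (x∙yz≈y∙xz)
open import Data.Nat.Tactic.RingSolver using (solve-∀)
open import Data.Product using (_×_; _,_; proj₁; proj₂)
open import Data.Sum using (_⊎_; inj₁; inj₂; [_,_]′; map₁)
open import Function using (_∘_)
open import Relation.Binary using (tri<; tri≈; tri>)
open import Relation.Binary.PropositionalEquality
open import Relation.Nullary using (Dec; ¬_; does; yes; no; contradiction)
open import Relation.Nullary.Decidable using (dec-true; dec-false)
open import Relation.Unary using (Decidable)

swap-fst : ∀ c d → swap c d c ≡ d
swap-fst c d rewrite dec-true (c ≟ c) refl = refl

swap-snd : ∀ c d → swap c d d ≡ c
swap-snd c d with d ≟ c
... | yes refl = swap-fst d d
... | no d≢c rewrite dec-false (d ≟ c) d≢c | dec-true (d ≟ d) refl = refl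

swap-other : ∀ {c d k} → k ≢ c → k ≢ d → swap c d k ≡ k
swap-other {c} {d} {k} k≢c k≢d rewrite dec-false (k ≟ c) k≢c | dec-false (k ≟ d) k≢d = refl

swap-involutive : ∀ c d k → swap c d (swap c d k) ≡ k
swap-involutive c d k with k ≟ c | k ≟ d
... | yes refl | _      = trans (cong (swap k d) (swap-fst k d)) (swap-snd k d)
... | no _     | yes refl = trans (cong (swap c k) (swap-snd c k)) (swap-fst c k)
... | no k≢c   | no k≢d = trans (cong (swap c d) (swap-other k≢c k≢d)) (swap-other k≢c k≢d)

swap-conjugate : ∀ {c m d} → c ≢ m → c ≢ d → m ≢ d → ∀ j → swap m d (swap c m (swap m d j)) ≡ swap c d j
swap-conjugate {c} {m} {d} c≢m c≢d m≢d j with j ≟ c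
... | yes refl rewrite swap-other c≢m c≢d | swap-fst j m | swap-fst m d | swap-fst j d = refl
... | no j≢c with j ≟ m
...   | yes refl rewrite swap-fst j d | swap-other (c≢d ∘ sym) (m≢d ∘ sym) | swap-snd j d
                       | swap-other j≢c m≢d = refl
...   | no j≢m with j ≟ d
...     | yes refl rewrite swap-snd m j | swap-snd c m | swap-other c≢m c≢d | swap-snd c j = refl
...     | no j≢d rewrite swap-other j≢m j≢d | swap-other j≢c j≢m | swap-other j≢m j≢d
                       | swap-other j≢c j≢d = refl

χ : ∀ {A : Set} → Dec A → ℕ
χ a? = if does a? then 1 else 0

χ-true : ∀ {A : Set} (a? : Dec A) → A → χ a? ≡ 1
χ-true a? a = cong (λ t → if t then 1 else 0) (dec-true a? a)

χ-false : ∀ {A : Set} (a? : Dec A) → ¬ A → χ a? ≡ 0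
χ-false a? ¬a = cong (λ t → if t then 1 else 0) (dec-false a? ¬a)

-- Counts j ∈ [1,n]; index 0 is never counted.
count : {P : ℕ → Set} → Decidable P → ℕ → ℕ
count P? zero    = 0
count P? (suc n) = χ (P? (suc n)) + count P? n

count-ext : ∀ {P Q : ℕ → Set} (P? : Decidable P) (Q? : Decidable Q) n →
            (∀ {j} → 1 ≤ j → j ≤ n → does (P? j) ≡ does (Q? j)) → count P? n ≡ count Q? n
count-ext P? Q? zero    _ = refl
count-ext P? Q? (suc n) h =
  cong₂ _+_ (cong (λ t → if t then 1 else 0) (h (s≤s z≤n) ≤-refl))
            (count-ext P? Q? n (λ 1≤j j≤n → h 1≤j (m≤n⇒m≤1+n j≤n)))

module _ {P : ℕ → Set} (P? : Decidable P) where

  count-yes : ∀ {n} → P (suc n) → count P? (suc n) ≡ suc (count P? n)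
  count-yes {n} p = cong (_+ count P? n) (χ-true (P? (suc n)) p)

  count-no : ∀ {n} → ¬ P (suc n) → count P? (suc n) ≡ count P? n
  count-no {n} ¬p = cong (_+ count P? n) (χ-false (P? (suc n)) ¬p)

  count-≤-suc : ∀ n → count P? (suc n) ≤ suc (count P? n)
  count-≤-suc n with P? (suc n)
  ... | yes _ = ≤-refl
  ... | no _  = n≤1+n _

  count-≤ : ∀ n → count P? n ≤ n
  count-≤ zero    = z≤n
  count-≤ (suc n) = ≤-trans (count-≤-suc n) (s≤s (count-≤ n))

  count-monoʳ : ∀ {m n} → m ≤ n → count P? m ≤ count P? n
  count-monoʳ = go ∘ ≤⇒≤′
    where
    go : ∀ {m n} → m ≤′ n → count P? m ≤ count P? n
    go ≤′-refl        = ≤-refl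
    go (≤′-step m≤′n) = ≤-trans (go m≤′n) (m≤n+m _ _)

  count-all : ∀ {n} → (∀ {j} → 1 ≤ j → j ≤ n → P j) → count P? n ≡ n
  count-all {zero}  _   = refl
  count-all {suc n} all =
    trans (count-yes (all (s≤s z≤n) ≤-refl)) (cong suc (count-all (λ 1≤j j≤n → all 1≤j (m≤n⇒m≤1+n j≤n))))

  count-none : ∀ {n} → (∀ {j} → 1 ≤ j → j ≤ n → ¬ P j) → count P? n ≡ 0
  count-none {zero}  _    = refl
  count-none {suc n} none =
    trans (count-no (none (s≤s z≤n) ≤-refl)) (count-none (λ 1≤j j≤n → none 1≤j (m≤n⇒m≤1+n j≤n)))

  count-< : ∀ {n j} → 1 ≤ j → j ≤ n → ¬ P j → count P? n < n
  count-< {zero}  (s≤s z≤n) ()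
  count-< {suc n} {j} 1≤j j≤1+n ¬pj with j ≟ suc n
  ... | yes refl = s≤s (≤-trans (≤-reflexive (count-no ¬pj)) (count-≤ n))
  ... | no j≢1+n = ≤-trans (s≤s (count-≤-suc n)) (s≤s (count-< 1≤j (≤-pred (≤∧≢⇒< j≤1+n j≢1+n)) ¬pj))

  count-unique : (∀ {i j} → P i → P j → i ≡ j) → ∀ n → count P? n ≤ 1
  count-unique unique zero    = z≤n
  count-unique unique (suc n) with P? (suc n)
  ... | yes p = s≤s (≤-reflexive (count-none (λ _ j≤n pj → <-irrefl (unique pj p) (s≤s j≤n))))
  ... | no _  = count-unique unique n

  count-⊎ : ∀ {Q R : ℕ → Set} (Q? : Decidable Q) (R? : Decidable R) →
            (∀ {j} → P j → Q j ⊎ R j) → ∀ n → count P? n ≤ count Q? n + count R? n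
  count-⊎ Q? R? split zero    = z≤n
  count-⊎ Q? R? split (suc n) with P? (suc n) | Q? (suc n) | R? (suc n)
  ... | yes _ | yes _ | _     = s≤s (≤-trans ih (+-monoʳ-≤ (count Q? n) (m≤n+m _ _)))
    where ih = count-⊎ Q? R? split n
  ... | yes _ | no _  | yes _ = ≤-trans (s≤s ih) (≤-reflexive (sym (+-suc _ _)))
    where ih = count-⊎ Q? R? split n
  ... | yes p | no ¬q | no ¬r = ⊥-elim ([ ¬q , ¬r ]′ (split p))
  ... | no _  | q?    | r?    =
    ≤-trans (count-⊎ Q? R? split n) (+-mono-≤ (m≤n+m (count Q? n) (χ q?)) (m≤n+m (count R? n) (χ r?)))

  count-swap : ∀ {c n} → 1 ≤ c → suc c ≤ n → count (P? ∘ swap c (suc c)) n ≡ count P? n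
  count-swap {c} {suc n} 1≤c (s≤s c<n) with m≤n⇒m<n∨m≡n c<n
  ... | inj₁ c+1<n =
    cong₂ _+_ (cong (χ ∘ P?) (swap-other (>⇒≢ (m<n⇒m<1+n c+1<n)) (>⇒≢ (s≤s c+1<n))))
              (count-swap 1≤c c+1<n)
  count-swap {suc c} {suc n} (s≤s z≤n) (s≤s _) | inj₂ refl = begin
    χ (P? (sw (suc (suc c)))) + (χ (P? (sw (suc c))) + count (P? ∘ sw) c)
      ≡⟨ cong₂ (λ s t → χ (P? s) + (χ (P? t) + count (P? ∘ sw) c))
               (swap-snd (suc c) (suc (suc c))) (swap-fst (suc c) (suc (suc c))) ⟩
    χ (P? (suc c)) + (χ (P? (suc (suc c))) + count (P? ∘ sw) c)
      ≡⟨ cong (λ s → χ (P? (suc c)) + (χ (P? (suc (suc c))) + s)) (count-ext _ P? c below) ⟩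
    χ (P? (suc c)) + (χ (P? (suc (suc c))) + count P? c)
      ≡⟨ x∙yz≈y∙xz (χ (P? (suc c))) (χ (P? (suc (suc c)))) (count P? c) ⟩
    χ (P? (suc (suc c))) + (χ (P? (suc c)) + count P? c) ∎
    where
    open ≡-Reasoning
    sw = swap (suc c) (suc (suc c))
    below : ∀ {j} → 1 ≤ j → j ≤ c → does (P? (sw j)) ≡ does (P? j)
    below _ j≤c = cong (does ∘ P?) (swap-other (<⇒≢ (s≤s j≤c)) (<⇒≢ (m<n⇒m<1+n (s≤s j≤c))))

fun-injective : ∀ (x : Perm) {i j} → fun x i ≡ fun x j → i ≡ j
fun-injective x {i} {j} xi≡xj = trans (sym (inv-fun x i)) (trans (cong (inv x) xi≡xj) (inv-fun x j))

fun-positive : ∀ (x : Perm) {i} → 1 ≤ i → 1 ≤ fun x i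
fun-positive x {i} 1≤i with fun x i in xi≡
... | suc _ = s≤s z≤n
... | zero  = contradiction (fun-injective x (trans xi≡ (sym (fix0 x)))) (>⇒≢ 1≤i)

transp-fst : ∀ x y {c d} → RightTransp y x c d → fun y c ≡ fun x d
transp-fst x y {c} {d} y=x·t = trans (y=x·t c) (cong (fun x) (swap-fst c d))

transp-snd : ∀ x y {c d} → RightTransp y x c d → fun y d ≡ fun x c
transp-snd x y {c} {d} y=x·t = trans (y=x·t d) (cong (fun x) (swap-snd c d))

transp-other : ∀ x y {c d k} → RightTransp y x c d → k ≢ c → k ≢ d → fun y k ≡ fun x k
transp-other x y {k = k} y=x·t k≢c k≢d = trans (y=x·t k) (cong (fun x) (swap-other k≢c k≢d))

transp-sym : ∀ x y {c d} → RightTransp y x c d → RightTransp x y c d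
transp-sym x y {c} {d} y=x·t j = sym (trans (y=x·t (swap c d j)) (cong (fun x) (swap-involutive c d j)))

_·⟨_,_⟩ : (x : Perm) (c d : ℕ) → .{{NonZero c}} → .{{NonZero d}} → Perm
x ·⟨ c , d ⟩ = record
  { fun     = fun x ∘ swap c d
  ; inv     = swap c d ∘ inv x
  ; inv-fun = λ j → trans (cong (swap c d) (inv-fun x (swap c d j))) (swap-involutive c d j)
  ; fun-inv = λ j → trans (cong (fun x) (swap-involutive c d (inv x j))) (fun-inv x j)
  ; fix0    = trans (cong (fun x) (swap-other (≢-nonZero⁻¹ c ∘ sym) (≢-nonZero⁻¹ d ∘ sym))) (fix0 x)
  ; bound   = bound x ⊔ c ⊔ d
  ; fixed   = λ j bound<j → trans (cong (fun x) (swap-other (>⇒≢ (≤-<-trans c≤bound bound<j))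
                                                            (>⇒≢ (≤-<-trans d≤bound bound<j))))
                                  (fixed x j (≤-<-trans x≤bound bound<j))
  }
  where
  x≤bound : bound x ≤ bound x ⊔ c ⊔ d
  x≤bound = ≤-trans (m≤m⊔n (bound x) c) (m≤m⊔n (bound x ⊔ c) d)
  c≤bound : c ≤ bound x ⊔ c ⊔ d
  c≤bound = ≤-trans (m≤n⊔m (bound x) c) (m≤m⊔n (bound x ⊔ c) d)
  d≤bound : d ≤ bound x ⊔ c ⊔ d
  d≤bound = m≤n⊔m (bound x ⊔ c) d

Stabilizes : Perm → ℕ → Set
Stabilizes w p = ∀ {j} → 1 ≤ j → j ≤ p → fun w j ≤ p

fixed-prefix⇒stabilizes : ∀ x {p} → (∀ {j} → 1 ≤ j → j ≤ p → fun x j ≡ j) → Stabilizes x p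
fixed-prefix⇒stabilizes x {p} fix 1≤j j≤p = subst (_≤ p) (sym (fix 1≤j j≤p)) j≤p

fixed-tail⇒stabilizes : ∀ x {n} → (∀ {j} → n < j → fun x j ≡ j) → Stabilizes x n
fixed-tail⇒stabilizes x {n} fix {j} _ j≤n with fun x j ≤? n
... | yes xj≤n = xj≤n
... | no xj≰n  = subst (_≤ n) (sym (fun-injective x (fix (≰⇒> xj≰n)))) j≤n

cntAbove≡count : ∀ f j k → cntAbove f j k ≡ count (λ i → f j <? f i) k
cntAbove≡count f j zero    = refl
cntAbove≡count f j (suc k) = cong (_+_ (χ (f j <? f (suc k)))) (cntAbove≡count f j k)

cntAbove-cong : ∀ {f g j j′} n → f j ≡ g j′ → (∀ {k} → 1 ≤ k → k ≤ n → f k ≡ g k) →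
                cntAbove f j n ≡ cntAbove g j′ n
cntAbove-cong {f} {g} {j} {j′} n fj≡gj′ f≡g = begin
  cntAbove f j n                  ≡⟨ cntAbove≡count f j n ⟩
  count (λ i → f j <? f i) n      ≡⟨ count-ext _ _ n (λ 1≤k k≤n → cong₂ (λ s t → does (s <? t)) fj≡gj′ (f≡g 1≤k k≤n)) ⟩
  count (λ i → g j′ <? g i) n     ≡⟨ cntAbove≡count g j′ n ⟨
  cntAbove g j′ n                 ∎
  where open ≡-Reasoning

invCount-cong : ∀ {f g} n → (∀ {k} → 1 ≤ k → k ≤ n → f k ≡ g k) → invCount f n ≡ invCount g n
invCount-cong zero    _   = refl
invCount-cong (suc n) f≡g =
  cong₂ _+_ (invCount-cong n (λ 1≤k k≤n → f≡g 1≤k (m≤n⇒m≤1+n k≤n)))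
            (cntAbove-cong n (f≡g (s≤s z≤n) ≤-refl) (λ 1≤k k≤n → f≡g 1≤k (m≤n⇒m≤1+n k≤n)))

ℓ≡invCount : ∀ (x : Perm) {N} → bound x ≤′ N → invCount (fun x) N ≡ ℓ x
ℓ≡invCount x ≤′-refl                  = refl
ℓ≡invCount x (≤′-step {N} bound≤′N) = begin
  invCount (fun x) N + cntAbove (fun x) (suc N) N ≡⟨ cong (_+_ (invCount (fun x) N)) no-inversions ⟩
  invCount (fun x) N + 0                          ≡⟨ +-identityʳ _ ⟩
  invCount (fun x) N                              ≡⟨ ℓ≡invCount x bound≤′N ⟩
  ℓ x                                             ∎
  where
  open ≡-Reasoning
  fixes-tail : ∀ {j} → N < j → fun x j ≡ j
  fixes-tail N<j = fixed x _ (≤-<-trans (≤′⇒≤ bound≤′N) N<j)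
  no-inversions : cntAbove (fun x) (suc N) N ≡ 0
  no-inversions = trans (cntAbove≡count (fun x) (suc N) N)
    (count-none _ λ 1≤i i≤N inversion →
      <⇒≱ inversion (subst (fun x _ ≤_) (sym (fixes-tail ≤-refl))
                      (m≤n⇒m≤1+n (fixed-tail⇒stabilizes x fixes-tail 1≤i i≤N))))

-- Only the pair of positions (i+1, i+2) changes status; each later row counts the same values in another order.
invCount-ascent : ∀ (f : ℕ → ℕ) i {N} → suc (suc i) ≤′ N → f (suc i) < f (suc (suc i)) →
                  invCount (f ∘ swap (suc i) (suc (suc i))) N ≡ suc (invCount f N)
invCount-ascent f i ≤′-refl asc = begin
  invCount g i + cntAbove g (suc i) i + (χ (g (suc (suc i)) <? g (suc i)) + cntAbove g (suc (suc i)) i)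
    ≡⟨ cong₂ _+_ (cong₂ _+_ (invCount-cong i below) (cntAbove-cong i g-fst below))
                 (cong₂ _+_ (trans (cong₂ (λ s t → χ (s <? t)) g-snd g-fst)
                                   (χ-true (f (suc i) <? f (suc (suc i))) asc))
                            (cntAbove-cong i g-snd below)) ⟩
  invCount f i + cntAbove f (suc (suc i)) i + (1 + cntAbove f (suc i) i)
    ≡⟨ rearrange (invCount f i) (cntAbove f (suc i) i) (cntAbove f (suc (suc i)) i) ⟩
  suc (invCount f i + cntAbove f (suc i) i + (0 + cntAbove f (suc (suc i)) i))
    ≡⟨ cong (λ t → suc (invCount f i + cntAbove f (suc i) i + (t + cntAbove f (suc (suc i)) i)))
            (χ-false (f (suc (suc i)) <? f (suc i)) (<-asym asc)) ⟨
  suc (invCount f (suc (suc i)))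
    ∎
  where
  open ≡-Reasoning
  g = f ∘ swap (suc i) (suc (suc i))
  g-fst : g (suc i) ≡ f (suc (suc i))
  g-fst = cong f (swap-fst (suc i) (suc (suc i)))
  g-snd : g (suc (suc i)) ≡ f (suc i)
  g-snd = cong f (swap-snd (suc i) (suc (suc i)))
  below : ∀ {k} → 1 ≤ k → k ≤ i → g k ≡ f k
  below _ k≤i = cong f (swap-other (<⇒≢ (s≤s k≤i)) (<⇒≢ (m<n⇒m<1+n (s≤s k≤i))))
  rearrange : ∀ I A B → I + B + (1 + A) ≡ suc (I + A + (0 + B))
  rearrange = solve-∀
invCount-ascent f i (≤′-step {N} 2+i≤′N) asc =
  cong₂ _+_ (invCount-ascent f i 2+i≤′N asc) (begin
    cntAbove g (suc N) N                ≡⟨ cntAbove≡count g (suc N) N ⟩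
    count (λ k → g (suc N) <? g k) N    ≡⟨ count-ext _ _ N (λ {k} _ _ → cong (λ t → does (t <? g k)) top-fixed) ⟩
    count (above ∘ swap (suc i) (suc (suc i))) N ≡⟨ count-swap above (s≤s z≤n) 2+i≤N ⟩
    count above N                       ≡⟨ cntAbove≡count f (suc N) N ⟨
    cntAbove f (suc N) N                ∎)
  where
  open ≡-Reasoning
  g = f ∘ swap (suc i) (suc (suc i))
  above = λ k → f (suc N) <? f k
  2+i≤N = ≤′⇒≤ 2+i≤′N
  top-fixed : g (suc N) ≡ f (suc N)
  top-fixed = cong f (swap-other (>⇒≢ (m<n⇒m<1+n 2+i≤N)) (>⇒≢ (s≤s 2+i≤N)))

ℓ-ascent : ∀ x y {i} → 1 ≤ i → RightTransp y x i (suc i) → fun x i < fun x (suc i) → ℓ y ≡ suc (ℓ x)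
ℓ-ascent x y {suc i} _ y=x·s asc = begin
  ℓ y                                          ≡⟨ ℓ≡invCount y (≤⇒≤′ y≤N) ⟨
  invCount (fun y) N                           ≡⟨ invCount-cong N (λ {k} _ _ → y=x·s k) ⟩
  invCount (fun x ∘ swap (suc i) (suc (suc i))) N ≡⟨ invCount-ascent (fun x) i (≤⇒≤′ (m≤n⊔m (bound x ⊔ bound y) _)) asc ⟩
  suc (invCount (fun x) N)                     ≡⟨ cong suc (ℓ≡invCount x (≤⇒≤′ x≤N)) ⟩
  suc (ℓ x)                                    ∎
  where
  open ≡-Reasoning
  N = bound x ⊔ bound y ⊔ suc (suc i)
  x≤N : bound x ≤ N
  x≤N = ≤-trans (m≤m⊔n (bound x) (bound y)) (m≤m⊔n _ _)
  y≤N : bound y ≤ N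
  y≤N = ≤-trans (m≤n⊔m (bound x) (bound y)) (m≤m⊔n _ _)

ℓ-descent : ∀ x y {i} → 1 ≤ i → RightTransp y x i (suc i) → fun x (suc i) < fun x i → suc (ℓ y) ≡ ℓ x
ℓ-descent x y 1≤i y=x·s desc =
  sym (ℓ-ascent y x 1≤i (transp-sym x y y=x·s) (subst₂ _<_ (sym (transp-fst x y y=x·s)) (sym (transp-snd x y y=x·s)) desc))

descent-of-ℓ< : ∀ x y {i} → 1 ≤ i → RightTransp y x i (suc i) → ℓ y < ℓ x → fun x (suc i) < fun x i
descent-of-ℓ< x y {i} 1≤i y=x·s ℓy<ℓx with <-cmp (fun x i) (fun x (suc i))
... | tri< asc _ _ = ⊥-elim (<-asym ℓy<ℓx (subst (ℓ x <_) (sym (ℓ-ascent x y 1≤i y=x·s asc)) (n<1+n (ℓ x))))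
... | tri≈ _ xi≡ _ = ⊥-elim (<-irrefl (fun-injective x xi≡) (n<1+n i))
... | tri> _ _ desc = desc

record LengthGain (x y : Perm) (c d : ℕ) : Set where
  field
    gain-1 : suc (ℓ x) ≤ ℓ y
    gain-3 : ∀ {e} → c < e → e < d → fun x c < fun x e → fun x e < fun x d → 3 + ℓ x ≤ ℓ y
open LengthGain

OppositeUnitSteps : ℕ → ℕ → ℕ → ℕ → Set
OppositeUnitSteps a a′ b′ b = (a′ ≡ suc a × suc b ≡ b′) ⊎ (suc a′ ≡ a × b ≡ suc b′)

opposite-steps-≤ : ∀ {k a a′ b′ b} → OppositeUnitSteps a a′ b′ b → k + a′ ≤ b′ → k + a ≤ b
opposite-steps-≤ {k} {a} {b = b} (inj₁ (refl , refl)) k+a′≤b′ = ≤-pred (subst (_≤ suc b) (+-suc k a) k+a′≤b′)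
opposite-steps-≤ {k} {a′ = a′} {b′} (inj₂ (refl , refl)) k+a′≤b′ = subst (_≤ suc b′) (sym (+-suc k a′)) (s≤s k+a′≤b′)

-- (c, m+1) = (m, m+1)(c, m)(m, m+1), so x·(c, m+1) = x″·(m, m+1); lengths are then compared by induction on m − c.
module TranspositionSplit (x : Perm) {c m : ℕ} (1≤c : 1 ≤ c) (c<m : c < m) where
  1≤m : 1 ≤ m
  1≤m = ≤-trans 1≤c (<⇒≤ c<m)

  instance
    c-nonZero : NonZero c
    c-nonZero = >-nonZero 1≤c
    m-nonZero : NonZero m
    m-nonZero = >-nonZero 1≤m

  c≢m : c ≢ m
  c≢m = <⇒≢ c<m
  c≢1+m : c ≢ suc m
  c≢1+m = <⇒≢ (m<n⇒m<1+n c<m)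
  m≢1+m : m ≢ suc m
  m≢1+m = <⇒≢ (n<1+n m)

  x′ x″ : Perm
  x′ = x ·⟨ m , suc m ⟩
  x″ = x′ ·⟨ c , m ⟩

  split-transp : ∀ y → RightTransp y x c (suc m) → RightTransp y x″ m (suc m)
  split-transp y y=x·t j = trans (y=x·t j) (cong (fun x) (sym (swap-conjugate c≢m c≢1+m m≢1+m j)))

  x′-other : ∀ {e} → e ≢ m → e ≢ suc m → fun x′ e ≡ fun x e
  x′-other = transp-other x x′ (λ _ → refl)
  x′-m : fun x′ m ≡ fun x (suc m)
  x′-m = transp-fst x x′ (λ _ → refl)
  x″-m : fun x″ m ≡ fun x c
  x″-m = trans (transp-snd x′ x″ (λ _ → refl)) (x′-other c≢m c≢1+m)
  x″-1+m : fun x″ (suc m) ≡ fun x m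
  x″-1+m = trans (transp-other x′ x″ (λ _ → refl) (c≢1+m ∘ sym) (m≢1+m ∘ sym)) (transp-snd x x′ (λ _ → refl))

transposition-gain : ∀ x y {c d} → 1 ≤ c → c <′ d → RightTransp y x c d → fun x c < fun x d → LengthGain x y c d
transposition-gain x y 1≤c ≤′-refl y=x·t asc = record
  { gain-1 = ≤-reflexive (sym (ℓ-ascent x y 1≤c y=x·t asc))
  ; gain-3 = λ c<e e<d → ⊥-elim (<⇒≱ e<d c<e)
  }
transposition-gain x y {c} {suc m} 1≤c (≤′-step c<′m) y=x·t asc = record
  { gain-1 = [ (λ mid → ≤-trans (m≤n+m _ 2) (middle-gain mid))
             , (λ (opposite , _) → opposite-steps-≤ opposite (gain-1 ih)) ]′ middle-or-outside
  ; gain-3 = λ c<e e<d xc<xe xe<xd →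
      [ middle-gain
      , (λ (opposite , e≢m) → opposite-steps-≤ opposite (ih-gain-3 (e≢m xc<xe xe<xd) c<e e<d xc<xe xe<xd)) ]′
      middle-or-outside
  }
  where
  open TranspositionSplit x 1≤c (≤′⇒≤ c<′m)
  y=x″·s : RightTransp y x″ m (suc m)
  y=x″·s = split-transp y y=x·t
  x′-c : fun x′ c ≡ fun x c
  x′-c = x′-other c≢m c≢1+m
  ih : LengthGain x′ x″ c m
  ih = transposition-gain x′ x″ 1≤c c<′m (λ _ → refl) (subst₂ _<_ (sym x′-c) (sym x′-m) asc)
  ih-gain-3 : ∀ {e} → e ≢ m → c < e → e < suc m → fun x c < fun x e → fun x e < fun x (suc m) → 3 + ℓ x′ ≤ ℓ x″
  ih-gain-3 {e} e≢m c<e e<1+m xc<xe xe<x1+m =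
    gain-3 ih c<e (≤∧≢⇒< (≤-pred e<1+m) e≢m) (subst₂ _<_ (sym x′-c) (sym x′-e) xc<xe) (subst₂ _<_ (sym x′-e) (sym x′-m) xe<x1+m)
    where
    x′-e : fun x′ e ≡ fun x e
    x′-e = x′-other e≢m (<⇒≢ e<1+m)
  middle-gain : fun x c < fun x m × fun x m < fun x (suc m) → 3 + ℓ x ≤ ℓ y
  middle-gain (xc<xm , xm<x1+m) = begin
    3 + ℓ x     ≡⟨ cong (λ n → 2 + n) (ℓ-ascent x x′ 1≤m (λ _ → refl) xm<x1+m) ⟨
    2 + ℓ x′    ≤⟨ s≤s (gain-1 ih) ⟩
    suc (ℓ x″)  ≡⟨ ℓ-ascent x″ y 1≤m y=x″·s (subst₂ _<_ (sym x″-m) (sym x″-1+m) xc<xm) ⟨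
    ℓ y         ∎
    where open ≤-Reasoning
  middle-or-outside : fun x c < fun x m × fun x m < fun x (suc m)
                    ⊎ OppositeUnitSteps (ℓ x) (ℓ x′) (ℓ x″) (ℓ y)
                      × (∀ {e} → fun x c < fun x e → fun x e < fun x (suc m) → e ≢ m)
  middle-or-outside with <-cmp (fun x m) (fun x c)
  ... | tri< xm<xc _ _ = inj₂
        ( inj₁ ( ℓ-ascent x x′ 1≤m (λ _ → refl) (<-trans xm<xc asc)
               , ℓ-descent x″ y 1≤m y=x″·s (subst₂ _<_ (sym x″-1+m) (sym x″-m) xm<xc))
        , λ { xc<xe _ refl → <-asym xm<xc xc<xe })
  ... | tri≈ _ xm≡xc _ = ⊥-elim (c≢m (sym (fun-injective x xm≡xc)))
  ... | tri> _ _ xc<xm with <-cmp (fun x m) (fun x (suc m))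
  ...   | tri< xm<x1+m _ _ = inj₁ (xc<xm , xm<x1+m)
  ...   | tri≈ _ xm≡x1+m _ = ⊥-elim (m≢1+m (fun-injective x xm≡x1+m))
  ...   | tri> _ _ x1+m<xm = inj₂
        ( inj₂ ( ℓ-descent x x′ 1≤m (λ _ → refl) x1+m<xm
               , ℓ-ascent x″ y 1≤m y=x″·s (subst₂ _<_ (sym x″-m) (sym x″-1+m) xc<xm))
        , λ { _ xe<x1+m refl → <-asym x1+m<xm xe<x1+m })

cover-has-no-middle : ∀ x y {c d e} → 1 ≤ c → c < e → e < d → RightTransp y x c d → ℓ y ≡ suc (ℓ x) →
                      fun x c < fun x e → fun x e < fun x d → ⊥
cover-has-no-middle x y 1≤c c<e e<d y=x·t ℓy≡ xc<xe xe<xd = 1+n≰n (≤-trans (n≤1+n _) (≤-pred 3+ℓx≤1+ℓx))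
  where
  3+ℓx≤1+ℓx : 3 + ℓ x ≤ suc (ℓ x)
  3+ℓx≤1+ℓx = subst (3 + ℓ x ≤_) ℓy≡
    (gain-3 (transposition-gain x y 1≤c (≤⇒≤′ (<-trans c<e e<d)) y=x·t (<-trans xc<xe xe<xd)) c<e e<d xc<xe xe<xd)

cover-ends-below-fixed-tail : ∀ x y {c d n} → (∀ {j} → n < j → fun x j ≡ j) → 1 ≤ c → c ≤ n →
                              RightTransp y x c d → ℓ y ≡ suc (ℓ x) → d ≤ suc n
cover-ends-below-fixed-tail x y {c} {d} {n} fixes-tail 1≤c c≤n y=x·t ℓy≡ with d ≤? suc n
... | yes d≤1+n = d≤1+n
... | no d≰1+n = ⊥-elim (cover-has-no-middle x y 1≤c (s≤s c≤n) 1+n<d y=x·t ℓy≡ xc<x1+n x1+n<xd)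
  where
  1+n<d = ≰⇒> d≰1+n
  xc<x1+n : fun x c < fun x (suc n)
  xc<x1+n = subst (fun x c <_) (sym (fixes-tail ≤-refl)) (s≤s (fixed-tail⇒stabilizes x fixes-tail 1≤c c≤n))
  x1+n<xd : fun x (suc n) < fun x d
  x1+n<xd = subst₂ _<_ (sym (fixes-tail ≤-refl)) (sym (fixes-tail (<-trans (n<1+n n) 1+n<d))) 1+n<d

rank : Perm → ℕ → ℕ → ℕ
rank w p q = count (λ j → fun w j ≤? q) p

rank-cong : ∀ x y {p q} → (∀ {j} → 1 ≤ j → j ≤ p → fun x j ≡ fun y j) → rank x p q ≡ rank y p q
rank-cong x y {p} {q} x≡y = count-ext _ _ p (λ 1≤j j≤p → cong (λ t → does (t ≤? q)) (x≡y 1≤j j≤p))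

rank-≤ : ∀ w p q → rank w p q ≤ q
rank-≤ w p zero    = ≤-reflexive (count-none (λ j → fun w j ≤? 0) {p} (λ 1≤j _ → <⇒≱ (fun-positive w 1≤j)))
rank-≤ w p (suc q) = begin
  rank w p (suc q)                               ≤⟨ count-⊎ _ _ (λ j → fun w j ≟ suc q) split p ⟩
  rank w p q + count (λ j → fun w j ≟ suc q) p   ≤⟨ +-mono-≤ (rank-≤ w p q) (count-unique _ hits-once p) ⟩
  q + 1                                          ≡⟨ +-comm q 1 ⟩
  suc q                                          ∎
  where
  open ≤-Reasoning
  split : ∀ {j} → fun w j ≤ suc q → fun w j ≤ q ⊎ fun w j ≡ suc q
  split = map₁ ≤-pred ∘ m≤n⇒m<n∨m≡n
  hits-once : ∀ {i j} → fun w i ≡ suc q → fun w j ≡ suc q → i ≡ j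
  hits-once wi≡ wj≡ = fun-injective w (trans wi≡ (sym wj≡))

rank-transp : ∀ x y {i p q} → 1 ≤ i → RightTransp y x i (suc i) → p ≢ i → rank y p q ≡ rank x p q
rank-transp x y {i} {p} {q} 1≤i y=x·s p≢i with p ≤? i
... | yes p≤i = rank-cong y x (λ _ j≤p → transp-other x y y=x·s (<⇒≢ (j<i j≤p)) (<⇒≢ (m<n⇒m<1+n (j<i j≤p))))
  where
  j<i : ∀ {j} → j ≤ p → j < i
  j<i j≤p = ≤-<-trans j≤p (≤∧≢⇒< p≤i p≢i)
... | no p≰i = trans (count-ext _ _ p (λ {j} _ _ → cong (λ t → does (t ≤? q)) (y=x·s j)))
                     (count-swap (λ j → fun x j ≤? q) 1≤i (≰⇒> p≰i))

-- Bruhat order, in its rank-count characterisation.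
_≤ᴮ_ : Perm → Perm → Set
v ≤ᴮ w = ∀ p q → rank w p q ≤ rank v p q

id-≤ᴮ : ∀ v w → IsId v → v ≤ᴮ w
id-≤ᴮ v w v≡1 p q with ≤-total p q
... | inj₁ p≤q = begin
  rank w p q  ≤⟨ count-≤ _ p ⟩
  p           ≡⟨ count-all _ (λ {j} _ j≤p → subst (_≤ q) (sym (v≡1 j)) (≤-trans j≤p p≤q)) ⟨
  rank v p q  ∎
  where open ≤-Reasoning
... | inj₂ q≤p = begin
  rank w p q  ≤⟨ rank-≤ w p q ⟩
  q           ≡⟨ count-all _ (λ {j} _ j≤q → subst (_≤ q) (sym (v≡1 j)) j≤q) ⟨
  rank v q q  ≤⟨ count-monoʳ _ q≤p ⟩
  rank v p q  ∎
  where open ≤-Reasoning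

-- At the descent i itself the inequality follows from those at i − 1 and i + 1.
≤ᴮ-at-descent : ∀ w r {i} → 1 ≤ i → (∀ p q → p ≢ i → rank r p q ≤ rank w p q) →
                fun r (suc i) ≤ fun r i → w ≤ᴮ r
≤ᴮ-at-descent w r {suc m} _ off-i r-desc p q with p ≟ suc m
... | no p≢i = off-i p q p≢i
... | yes refl with fun r (suc m) ≤? q
...   | no ri≰q = begin
  rank r (suc m) q  ≡⟨ count-no (λ j → fun r j ≤? q) ri≰q ⟩
  rank r m q        ≤⟨ off-i m q (<⇒≢ (n<1+n m)) ⟩
  rank w m q        ≤⟨ m≤n+m (rank w m q) _ ⟩
  rank w (suc m) q  ∎
  where open ≤-Reasoning
...   | yes ri≤q = ≤-pred (begin
  suc (rank r (suc m) q)  ≡⟨ count-yes (λ j → fun r j ≤? q) (≤-trans r-desc ri≤q) ⟨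
  rank r (suc (suc m)) q  ≤⟨ off-i (suc (suc m)) q (>⇒≢ (n<1+n (suc m))) ⟩
  rank w (suc (suc m)) q  ≤⟨ count-≤-suc (λ j → fun w j ≤? q) (suc m) ⟩
  suc (rank w (suc m) q)  ∎)
  where open ≤-Reasoning

demazure-≥ᴮ : ∀ {u w r} → Dem u w r → w ≤ᴮ r
demazure-≥ᴮ {w = w} {r} (dem-one w≡1 _) = id-≤ᴮ w r w≡1
demazure-≥ᴮ {w = w} {r} (dem-asc {w' = w′} {r' = r′} i 1≤i w=w′·s _ w′∘ r=r′·s ℓr′<ℓr) =
  ≤ᴮ-at-descent w r 1≤i
    (λ p q p≢i → begin
      rank r p q   ≡⟨ rank-transp r′ r 1≤i r=r′·s p≢i ⟩
      rank r′ p q  ≤⟨ demazure-≥ᴮ w′∘ p q ⟩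
      rank w′ p q  ≡⟨ rank-transp w′ w 1≤i w=w′·s p≢i ⟨
      rank w p q   ∎)
    (<⇒≤ (descent-of-ℓ< r r′ 1≤i (transp-sym r′ r r=r′·s) ℓr′<ℓr))
  where open ≤-Reasoning
demazure-≥ᴮ {w = w} {r} (dem-des {w' = w′} {r' = r′} {t = t} i 1≤i w=w′·s _ w′∘ t=r′·s ℓt<ℓr′ r≈r′) =
  ≤ᴮ-at-descent w r 1≤i
    (λ p q p≢i → begin
      rank r p q   ≡⟨ rank-cong r r′ {p} {q} (λ {j} _ _ → r≈r′ j) ⟩
      rank r′ p q  ≤⟨ demazure-≥ᴮ w′∘ p q ⟩
      rank w′ p q  ≡⟨ rank-transp w′ w 1≤i w=w′·s p≢i ⟨
      rank w p q   ∎)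
    (subst₂ _≤_ (sym (r≈r′ _)) (sym (r≈r′ _)) (<⇒≤ (descent-of-ℓ< r′ t 1≤i t=r′·s ℓt<ℓr′)))
  where open ≤-Reasoning

≤ᴮ-stabilizes : ∀ v z {p} → v ≤ᴮ z → Stabilizes z p → Stabilizes v p
≤ᴮ-stabilizes v z {p} v≤z z-stable {j} 1≤j j≤p with fun v j ≤? p
... | yes vj≤p = vj≤p
... | no vj≰p = ⊥-elim (<⇒≱ (count-< _ 1≤j j≤p vj≰p) (begin
  p           ≡⟨ count-all _ z-stable ⟨
  rank z p p  ≤⟨ v≤z p p ⟩
  rank v p p  ∎))
  where open ≤-Reasoning

stabilizes-fixes : ∀ v {p} → Stabilizes v p → Stabilizes v (suc p) → fun v (suc p) ≡ suc p
stabilizes-fixes v {p} stable-p stable-1+p with m≤n⇒m<n∨m≡n (stable-1+p (s≤s z≤n) ≤-refl)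
... | inj₂ fixed = fixed
... | inj₁ (s≤s v1+p≤p) = ⊥-elim (1+n≰n (begin
  suc p             ≡⟨ count-all _ maps-into ⟨
  rank v (suc p) p  ≤⟨ rank-≤ v (suc p) p ⟩
  p                 ∎))
  where
  open ≤-Reasoning
  maps-into : ∀ {j} → 1 ≤ j → j ≤ suc p → fun v j ≤ p
  maps-into {j} 1≤j j≤1+p with j ≟ suc p
  ... | yes refl = v1+p≤p
  ... | no j≢1+p = stable-p 1≤j (≤-pred (≤∧≢⇒< j≤1+p j≢1+p))

binv-fixes : ∀ z v {p} → InBinv z v → Stabilizes z p → Stabilizes z (suc p) → fun v (suc p) ≡ suc p
binv-fixes z v v∈ z-stable-p z-stable-1+p =
  stabilizes-fixes v (≤ᴮ-stabilizes v z (demazure-≥ᴮ v∈) z-stable-p) (≤ᴮ-stabilizes v z (demazure-≥ᴮ v∈) z-stable-1+p)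

suppIn-fixed : ∀ w {lo hi i} → SuppIn w lo hi → 1 ≤ i → + i ℤ.< lo ⊎ hi ℤ.< + i → fun w i ≡ i
suppIn-fixed w {i = i} w⊆ 1≤i outside with fun w i ≟ i
... | yes fixed = fixed
... | no moved with w⊆ i 1≤i moved | outside
...   | lo≤i , _ | inj₁ i<lo = ⊥-elim (ℤP.<⇒≱ i<lo lo≤i)
...   | _ , i≤hi | inj₂ hi<i = ⊥-elim (ℤP.<⇒≱ hi<i i≤hi)

suppIn-intro : ∀ w {lo hi} → (∀ {i} → 1 ≤ i → + i ℤ.< lo ⊎ hi ℤ.< + i → fun w i ≡ i) → SuppIn w lo hi
suppIn-intro w {lo} {hi} fixes-outside i 1≤i moved with lo ℤP.≤? + i | + i ℤP.≤? hi
... | yes lo≤i | yes i≤hi = lo≤i , i≤hi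
... | no lo≰i  | _        = contradiction (fixes-outside 1≤i (inj₁ (ℤP.≰⇒> lo≰i))) moved
... | _        | no i≰hi  = contradiction (fixes-outside 1≤i (inj₂ (ℤP.≰⇒> i≰hi))) moved

suppIn-≈ : ∀ x y {lo hi} → x ≈ y → SuppIn x lo hi → SuppIn y lo hi
suppIn-≈ x y x≈y x⊆ i 1≤i moved = x⊆ i 1≤i (λ fixed → moved (trans (sym (x≈y i)) fixed))

suppIn-widen : ∀ x {lo hi lo′ hi′} → lo′ ℤ.≤ lo → hi ℤ.≤ hi′ → SuppIn x lo hi → SuppIn x lo′ hi′
suppIn-widen x lo′≤lo hi≤hi′ x⊆ i 1≤i moved =
  ℤP.≤-trans lo′≤lo (proj₁ (x⊆ i 1≤i moved)) , ℤP.≤-trans (proj₂ (x⊆ i 1≤i moved)) hi≤hi′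

suppIn-transp : ∀ x y {lo hi c d} → RightTransp y x c d → SuppIn x lo hi →
                lo ℤ.≤ + c → + d ℤ.≤ hi → c ≤ d → SuppIn y lo hi
suppIn-transp x y {c = c} {d} y=x·t x⊆ lo≤c d≤hi c≤d i 1≤i moved with i ≟ c | i ≟ d
... | yes refl | _        = lo≤c , ℤP.≤-trans (+≤+ c≤d) d≤hi
... | no _     | yes refl = ℤP.≤-trans lo≤c (+≤+ c≤d) , d≤hi
... | no i≢c   | no i≢d   = x⊆ i 1≤i (λ fixed → moved (trans (transp-other x y y=x·t i≢c i≢d) fixed))

binv-suppIn : ∀ z v {lo hi} → SuppIn z lo hi → InBinv z v → SuppIn v lo hi
binv-suppIn z v {lo} {hi} z⊆ v∈ = suppIn-intro v λ { {suc p} _ outside →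
  binv-fixes z v v∈ (proj₁ (stable-around outside)) (proj₂ (stable-around outside)) }
  where
  stable-around : ∀ {p} → + suc p ℤ.< lo ⊎ hi ℤ.< + suc p → Stabilizes z p × Stabilizes z (suc p)
  stable-around {p} (inj₁ 1+p<lo) =
    fixed-prefix⇒stabilizes z (λ 1≤j j≤p → fixes-prefix 1≤j (m≤n⇒m≤1+n j≤p)) , fixed-prefix⇒stabilizes z fixes-prefix
    where
    fixes-prefix : ∀ {j} → 1 ≤ j → j ≤ suc p → fun z j ≡ j
    fixes-prefix 1≤j j≤1+p = suppIn-fixed z z⊆ 1≤j (inj₁ (ℤP.≤-<-trans (+≤+ j≤1+p) 1+p<lo))
  stable-around {p} (inj₂ hi<1+p) =
    fixed-tail⇒stabilizes z fixes-tail , fixed-tail⇒stabilizes z (fixes-tail ∘ ≤-trans (n≤1+n _))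
    where
    fixes-tail : ∀ {j} → p < j → fun z j ≡ j
    fixes-tail p<j = suppIn-fixed z z⊆ (≤-trans (s≤s z≤n) p<j) (inj₂ (ℤP.<-≤-trans hi<1+p (+≤+ p<j)))

lower-bound-pred : ∀ {lo m n} → lo ℤ.≤ + suc m → m ≤ n → lo ℤ.- 1ℤ ℤ.≤ + n
lower-bound-pred lo≤1+m m≤n = ℤP.≤-trans (ℤP.+-monoˡ-≤ (ℤ.- 1ℤ) lo≤1+m) (+≤+ m≤n)

upper-bound-suc : ∀ {hi m n} → n ≤ suc m → + m ℤ.≤ hi → + n ℤ.≤ hi ℤ.+ 1ℤ
upper-bound-suc {hi} n≤1+m m≤hi =
  ℤP.≤-trans (+≤+ n≤1+m) (subst (+ _ ℤ.≤_) (ℤP.+-comm 1ℤ hi) (ℤP.+-monoʳ-≤ 1ℤ m≤hi))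

cover-upper-bound : ∀ x y {lo hi c d} → SuppIn x lo hi → 1 ≤ c → + c ℤ.≤ hi →
                    RightTransp y x c d → ℓ y ≡ suc (ℓ x) → + d ℤ.≤ hi ℤ.+ 1ℤ
cover-upper-bound x y {hi = + n} x⊆ 1≤c (+≤+ c≤n) y=x·t ℓy≡ =
  upper-bound-suc (cover-ends-below-fixed-tail x y fixes-tail 1≤c c≤n y=x·t ℓy≡) ℤP.≤-refl
  where
  fixes-tail : ∀ {j} → n < j → fun x j ≡ j
  fixes-tail n<j = suppIn-fixed x x⊆ (≤-trans (s≤s z≤n) n<j) (inj₂ (+<+ n<j))

lower-bound-j : ∀ z {lo hi jz} → SuppIn z lo hi → IsJ z jz → ¬ IsId z → lo ℤ.≤ + suc jz
lower-bound-j z {lo} {jz = jz} z⊆ (_ , j-max) z≢1 with lo ℤP.≤? + suc jz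
... | yes lo≤1+jz = lo≤1+jz
... | no lo≰1+jz = ⊥-elim (1+n≰n (proj₂ (j-max z≢1) (suc jz) fixes-prefix))
  where
  fixes-prefix : InitFixed z (suc jz)
  fixes-prefix t 1≤t t≤1+jz = suppIn-fixed z z⊆ 1≤t (inj₁ (ℤP.≤-<-trans (+≤+ t≤1+jz) (ℤP.≰⇒> lo≰1+jz)))

pieri-b≤b₁ : ∀ {k v w} (ch : PieriChain k v w) {i} → 1 ≤ i → i ≤ q ch → b ch i ≤ b ch 1
pieri-b≤b₁ ch {suc zero}    _ _ = ≤-refl
pieri-b≤b₁ ch {suc (suc i)} _ 2+i≤q =
  ≤-trans (P1 ch (suc i) (s≤s z≤n) 2+i≤q) (pieri-b≤b₁ ch (s≤s z≤n) (≤-trans (n≤1+n _) 2+i≤q))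

pieri-suppIn : ∀ {k v w lo hi} (ch : PieriChain k v w) → SuppIn v lo hi →
               (∀ {i} → 1 ≤ i → i ≤ q ch → lo ℤ.≤ + a ch i × + b ch i ℤ.≤ hi) → SuppIn w lo hi
pieri-suppIn {v = v} {w} {lo} {hi} ch v⊆ in-range = suppIn-≈ (vs ch (q ch)) w (end ch) (steps (q ch) ≤-refl)
  where
  steps : ∀ i → i ≤ q ch → SuppIn (vs ch i) lo hi
  steps zero    _     = suppIn-≈ v (vs ch 0) (λ j → sym (start ch j)) v⊆
  steps (suc i) 1+i≤q = suppIn-transp (vs ch i) (vs ch (suc i)) (proj₁ (proj₂ step)) (steps i (≤-trans (n≤1+n i) 1+i≤q))
                          (proj₁ (in-range (s≤s z≤n) 1+i≤q)) (proj₂ (in-range (s≤s z≤n) 1+i≤q)) (<⇒≤ (proj₁ step))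
    where step = cover ch (suc i) (s≤s z≤n) 1+i≤q

zchain-lower-bound : ∀ z {lo hi jz x y} → SuppIn z lo hi → IsJ z jz → jz ≤ x → 1 ≤ x →
                     x < fun z x ⊎ fun z y < y → lo ℤ.- 1ℤ ℤ.≤ + x
zchain-lower-bound z z⊆ _ _ 1≤x (inj₁ x<zx) =
  lower-bound-pred (ℤP.≤-trans (proj₁ (z⊆ _ 1≤x (>⇒≢ x<zx))) (+≤+ (n≤1+n _))) ≤-refl
zchain-lower-bound z z⊆ isJ jz≤x _ (inj₂ zy<y) =
  lower-bound-pred (lower-bound-j z z⊆ isJ (λ z≡1 → <⇒≢ zy<y (z≡1 _))) jz≤x

zchain-upper-bound : ∀ z v {k w lo hi} (ch : PieriChain k v w) → SuppIn z lo hi → SuppIn v lo hi → 1 ≤ q ch →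
                     a ch 1 < fun z (a ch 1) ⊎ fun z (b ch 1) < b ch 1 → + b ch 1 ℤ.≤ hi ℤ.+ 1ℤ
zchain-upper-bound z v ch z⊆ v⊆ 1≤q (inj₁ a<za) =
  cover-upper-bound (vs ch 0) (vs ch 1) (suppIn-≈ v (vs ch 0) (λ j → sym (start ch j)) v⊆)
    1≤a (proj₂ (z⊆ _ 1≤a (>⇒≢ a<za))) (proj₁ (proj₂ (cover ch 1 ≤-refl 1≤q))) (proj₂ (proj₂ (cover ch 1 ≤-refl 1≤q)))
  where
  1≤a = proj₁ (range ch 1 ≤-refl 1≤q)
zchain-upper-bound z v ch z⊆ v⊆ 1≤q (inj₂ zb<b) = upper-bound-suc (n≤1+n _) (proj₂ (z⊆ _ 1≤b (<⇒≢ zb<b)))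
  where
  1≤b = ≤-trans (proj₁ (range ch 1 ≤-refl 1≤q)) (<⇒≤ (proj₁ (cover ch 1 ≤-refl 1≤q)))

proposition3p20 : (z : Perm) → IsInvolution z → (a b : ℤ) → a ℤ.≤ b →
    SuppIn z a b →
    ((v : Perm) → InBinv z v → SuppIn v a b)
    × ((w : Perm) → InBinvPlus z w → SuppIn w (a ℤ.- 1ℤ) (b ℤ.+ 1ℤ))
proposition3p20 z _ lo hi _ z⊆ = v⊆ , w⊆
  where
  v⊆ : (v : Perm) → InBinv z v → SuppIn v lo hi
  v⊆ v = binv-suppIn z v z⊆
  w⊆ : (w : Perm) → InBinvPlus z w → SuppIn w (lo ℤ.- 1ℤ) (hi ℤ.+ 1ℤ)
  w⊆ w (v , v∈ , _ , _ , _ , isJ , ch , marked) =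
    pieri-suppIn ch (suppIn-widen v (ℤP.i-j≤i lo 1ℤ) (ℤP.i≤i+j hi 1ℤ) (v⊆ v v∈)) λ {i} 1≤i i≤q →
        zchain-lower-bound z z⊆ isJ (proj₁ (marked i 1≤i i≤q)) (proj₁ (range ch i 1≤i i≤q)) (proj₂ (marked i 1≤i i≤q))
      , ℤP.≤-trans (+≤+ (pieri-b≤b₁ ch 1≤i i≤q))
          (zchain-upper-bound z v ch z⊆ (v⊆ v v∈) (≤-trans 1≤i i≤q) (proj₂ (marked 1 ≤-refl (≤-trans 1≤i i≤q))))
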